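{- Let $T=(\alpha_1,\dots,\alpha_{k+1})$ be the semitrace of an operation array $M=(\mu_1,\dots,\mu_k)$ of length $n+1$, and let $(a,b)$ be a violating pair of $T$. Then there exist $i\in\{2,\dots,k\}$ and a block of $\alpha_i$ with respect to $\mu_i$ that contains both $a$ and $b$.
   Context: An operation sequence of length $n+1$ is a word $c_1\dots c_{n+1}$ over $\{\mathtt{a},\mathtt{d}\}$ with $c_1=c_{n+1}=\mathtt{a}$. For a permutation $\pi$ of $[n]$ and operation sequence $\mu$ with $\mathtt{a}$'s at indices $i_1<\dots<i_t$, the blocks of $\pi$ w.r.t. $\mu$ are the contiguous factors at positions $i_j,\dots,i_{j+1}-1$, and $\mathrm{rev}(\pi,\mu)$ reverses each block. An operation array of order $k$ is a $k$-tuple $M=(\mu_1,\dots,\mu_k)$ of operation sequences of length $n+1$; its semitrace is $(\alpha_1,\dots,\alpha_{k+1})$ with $\alpha_{k+1}$ the identity permutation of $[n]$ and $\alpha_i=\mathrm{rev}(\alpha_{i+1},\mu_i)$ for $i=k,\dots,1$. A violating pair is a pair $(a,b)$ of distinct elements of $[n]$ such that for some $i\in[k]$, $a$ and $b$ occupy adjacent positions $m,m+1$ of $\alpha_i$ (in either order) and either $\alpha_i(m)>\alpha_i(m+1)$ and the $(m+1)$-st letter of $\mu_i$ is $\mathtt{a}$, or $\alpha_i(m)<\alpha_i(m+1)$ and the $(m+1)$-st letter of $\mu_i$ is $\mathtt{d}$. -}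

module Defs where

open import Data.Nat using (ℕ; zero; suc; _<_; _>_)
open import Data.List using (List; []; _∷_; _++_; length; head; last; map; concat; reverse; upTo)
open import Data.List.Membership.Propositional using (_∈_)
open import Data.Maybe using (Maybe; just)
open import Data.Product using (_×_; _,_; proj₁; proj₂; ∃-syntax)
open import Data.Sum using (_⊎_)
open import Data.Vec using (Vec; []; _∷_; lookup)
open import Data.Fin using (Fin; inject₁)
open import Relation.Binary.PropositionalEquality using (_≡_)
open import Relation.Nullary using (¬_)

data Letter : Set where
  opA opD : Letter

IsOpSeq : ℕ → List Letter → Set
IsOpSeq n μ = (length μ ≡ suc n) × (head μ ≡ just opA) × (last μ ≡ just opA)

-- Permutations of [n] are lists of their values (one-line notation); values are 1..n.
identity : ℕ → List ℕ
identity n = map suc (upTo n)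

-- Splitting π = π₁…πₙ into blocks w.r.t. μ = c₁…c_{n+1}: a new block starts at
-- every position j ≤ n with c_j = a (c_{n+1} = a just closes the last block).
-- go returns (initial segment not yet preceded by an a, following blocks).
private
  go : List Letter → List ℕ → List ℕ × List (List ℕ)
  go (c ∷ cs) (x ∷ xs) with go cs xs
  ... | cur , bs with c
  ...   | opA = [] , (x ∷ cur) ∷ bs
  ...   | opD = x ∷ cur , bs
  go _ _ = [] , []

  prepend : List ℕ → List (List ℕ) → List (List ℕ)
  prepend [] bs = bs
  prepend (x ∷ xs) bs = (x ∷ xs) ∷ bs

blocks : List ℕ → List Letter → List (List ℕ)
blocks π μ = prepend (proj₁ (go μ π)) (proj₂ (go μ π))

rev : List ℕ → List Letter → List ℕ
rev π μ = concat (map reverse (blocks π μ))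

-- semitrace (α₁,…,α_{k+1}) of M = (μ₁,…,μ_k); α_{k+1} = id, α_i = rev(α_{i+1}, μ_i).
-- Index j : Fin (suc k) stands for α_{j+1}.
semitrace : (n : ℕ) {k : ℕ} → Vec (List Letter) k → Vec (List ℕ) (suc k)
semitrace n [] = identity n ∷ []
semitrace n (μ ∷ M) with semitrace n M
... | α ∷ T = rev α μ ∷ α ∷ T

-- the (j+1)-st letter (1-indexed) of μ is c
LetterAt : List Letter → ℕ → Letter → Set
LetterAt μ j c = ∃[ pre ] ∃[ post ] (μ ≡ pre ++ c ∷ post × length pre ≡ j)

-- (a,b) is violating at the step with permutation α and operation sequence μ:
-- α = pre ++ x ∷ y ∷ post, {x,y} = {a,b}, x at position m = length pre + 1,
-- and (x > y and letter m+1 is a) or (x < y and letter m+1 is d).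
ViolatingAt : List ℕ → List Letter → ℕ → ℕ → Set
ViolatingAt α μ a b =
  ∃[ pre ] ∃[ x ] ∃[ y ] ∃[ post ]
    ( α ≡ pre ++ x ∷ y ∷ post
    × ((x ≡ a × y ≡ b) ⊎ (x ≡ b × y ≡ a))
    × ((x > y × LetterAt μ (suc (length pre)) opA)
       ⊎ (x < y × LetterAt μ (suc (length pre)) opD)))

-- (a,b) is a violating pair of the semitrace of M (i ranges over [k]; i = j+1)
ViolatingPair : (n : ℕ) {k : ℕ} → Vec (List Letter) k → ℕ → ℕ → Set
ViolatingPair n {k} M a b =
  ¬ (a ≡ b) × ∃[ j ] ViolatingAt (lookup (semitrace n M) (inject₁ j)) (lookup M j) a b

module Submission where

-- The block boundaries depend only on μ and the length of π, so reversing the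
-- blocks is an involution and α_{i+1} = rev(α_i, μ_i).
-- A violation at step i makes (a, b) an inversion of α_{i+1}: across a block
-- boundary the pair keeps its decreasing order, inside a block its increasing
-- order is reversed. Passing from α_j to α_{j+1} reverses every block of α_j, so
-- a pair in different blocks keeps its relative order; since α_{k+1} is the
-- identity, the inversion must be resolved inside a block of some α_j, j ≥ i+1 ≥ 2.

open import Defs
open import Data.Nat using (ℕ; suc; _+_; _≤_; _<_; _>_; z≤n; s≤s)
open import Data.Nat.Properties using (≤-trans; ≤-reflexive; n≤1+n; <-asym; suc-injective)
open import Data.List using (List; []; _∷_; _++_; length; map; concat; reverse; upTo)
open import Data.List.Properties using (∷-injective; ∷-injectiveˡ; ∷-injectiveʳ; length-++; length-map; length-upTo; map-upTo; map-∘; map-cong; map-id; length-reverse; reverse-involutive; ʳ++-defn)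
open import Data.List.Membership.Propositional using (_∈_)
open import Data.List.Membership.Propositional.Properties using (∈-concat⁺′; ∈-concat⁻′; ∈-map⁺)
open import Data.List.Relation.Unary.Any using (here; there)
open import Data.List.Relation.Unary.Any.Properties using (++⁺ˡ; ++⁺ʳ; ++⁻; reverse⁺)
import Data.List.Relation.Unary.All as ListAll
open import Data.List.Relation.Unary.AllPairs using (AllPairs; _∷_)
open import Data.List.Relation.Unary.AllPairs.Properties using (applyUpTo⁺₁)
open import Data.Vec using (Vec; []; _∷_; lookup)
open import Data.Vec.Relation.Unary.All using (All; []; _∷_)
open import Data.Vec.Relation.Unary.All.Properties using (lookup⁺)
open import Data.Fin using (Fin; zero; suc; toℕ; inject₁)
open import Data.Product using (_×_; _,_; proj₁; proj₂; ∃-syntax)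
open import Data.Sum using (_⊎_; inj₁; inj₂; swap; [_,_]′) renaming (map to map-⊎; map₂ to map₂-⊎)
open import Data.Empty using (⊥-elim)
open import Function using (_∘_; id)
open import Level using (Level)
open import Relation.Nullary using (¬_)
open import Relation.Binary.PropositionalEquality using (_≡_; refl; sym; trans; cong; cong₂; subst; subst₂; module ≡-Reasoning)

private
  variable
    ℓ : Level
    A : Set ℓ

++-injective : ∀ (xs ys : List A) {us vs} → length xs ≡ length ys → xs ++ us ≡ ys ++ vs → xs ≡ ys × us ≡ vs
++-injective []       []       _ e = refl , e
++-injective (x ∷ xs) (y ∷ ys) l e =
  let x≡y , e′ = ∷-injective e
      xs≡ys , us≡vs = ++-injective xs ys (suc-injective l) e′
  in cong₂ _∷_ x≡y xs≡ys , us≡vs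

concat-injective : ∀ (bs cs : List (List A)) → map length bs ≡ map length cs → concat bs ≡ concat cs → bs ≡ cs
concat-injective []       []       _ _ = refl
concat-injective (b ∷ bs) (c ∷ cs) l e =
  let b≡c , e′ = ++-injective b c (∷-injectiveˡ l) e
  in cong₂ _∷_ b≡c (concat-injective bs cs (∷-injectiveʳ l) e′)

length-reverseEach : ∀ (bs : List (List A)) → length (concat (map reverse bs)) ≡ length (concat bs)
length-reverseEach []       = refl
length-reverseEach (b ∷ bs) = begin
  length (reverse b ++ concat (map reverse bs))         ≡⟨ length-++ (reverse b) ⟩
  length (reverse b) + length (concat (map reverse bs)) ≡⟨ cong₂ _+_ (length-reverse b) (length-reverseEach bs) ⟩
  length b + length (concat bs)                         ≡⟨ length-++ b ⟨
  length (b ++ concat bs)                               ∎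
  where open ≡-Reasoning

map-length-reverseEach : ∀ (bs : List (List A)) → map length (map reverse bs) ≡ map length bs
map-length-reverseEach bs = trans (sym (map-∘ bs)) (map-cong length-reverse bs)

reverseEach-involutive : ∀ (bs : List (List A)) → map reverse (map reverse bs) ≡ bs
reverseEach-involutive bs = trans (sym (map-∘ bs)) (trans (map-cong reverse-involutive bs) (map-id bs))

-- Defs keeps the splitting function behind `blocks` private; unifying against
-- the reduct of `blocks` recovers it.
mutual
  split : List Letter → List ℕ → List ℕ × List (List ℕ)
  split = _

  blocks-opA∷ : ∀ x cs xs → blocks (x ∷ xs) (opA ∷ cs) ≡ (x ∷ proj₁ (split cs xs)) ∷ proj₂ (split cs xs)
  blocks-opA∷ _ _ _ = refl

shape : List ℕ × List (List ℕ) → ℕ × List ℕ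
shape (c , bs) = length c , map length bs

split-shape : ∀ μ {π π′ : List ℕ} → length π ≡ length π′ → shape (split μ π) ≡ shape (split μ π′)
split-shape []        _ = refl
split-shape (_ ∷ _)   {[]}    {[]}     _ = refl
split-shape (_ ∷ _)   {[]}    {_ ∷ _}  ()
split-shape (_ ∷ _)   {_ ∷ _} {[]}     ()
split-shape (opA ∷ μ) {_ ∷ _} {_ ∷ _}  e = cong (λ (l , ls) → 0 , suc l ∷ ls) (split-shape μ (suc-injective e))
split-shape (opD ∷ μ) {_ ∷ _} {_ ∷ _}  e = cong (λ (l , ls) → suc l , ls) (split-shape μ (suc-injective e))

split-concat : ∀ μ π → length π ≤ length μ → proj₁ (split μ π) ++ concat (proj₂ (split μ π)) ≡ π
split-concat []        []      _         = refl
split-concat (_ ∷ _)   []      _         = refl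
split-concat (opA ∷ μ) (x ∷ π) (s≤s π≤μ) = cong (x ∷_) (split-concat μ π π≤μ)
split-concat (opD ∷ μ) (x ∷ π) (s≤s π≤μ) = cong (x ∷_) (split-concat μ π π≤μ)

prependSegment : List ℕ × List (List ℕ) → List (List ℕ)
prependSegment ([]         , bs) = bs
prependSegment (c@(_ ∷ _) , bs) = c ∷ bs

blocks-split : ∀ π μ → blocks π μ ≡ prependSegment (split μ π)
blocks-split π       []        = refl
blocks-split []      (_ ∷ _)   = refl
blocks-split (_ ∷ _) (opA ∷ _) = refl
blocks-split (_ ∷ _) (opD ∷ _) = refl

prependSegment-shape : ∀ s s′ → shape s ≡ shape s′ → map length (prependSegment s) ≡ map length (prependSegment s′)
prependSegment-shape ([]    , _) ([]    , _) e = cong proj₂ e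
prependSegment-shape (_ ∷ _ , _) (_ ∷ _ , _) e = cong₂ _∷_ (cong proj₁ e) (cong proj₂ e)
prependSegment-shape ([]    , _) (_ ∷ _ , _) ()
prependSegment-shape (_ ∷ _ , _) ([]    , _) ()

concat-prependSegment : ∀ s → concat (prependSegment s) ≡ proj₁ s ++ concat (proj₂ s)
concat-prependSegment ([]    , _) = refl
concat-prependSegment (_ ∷ _ , _) = refl

reverseSegments : List ℕ × List (List ℕ) → List ℕ
reverseSegments (c , bs) = reverse c ++ concat (map reverse bs)

reverseEach-prependSegment : ∀ s → concat (map reverse (prependSegment s)) ≡ reverseSegments s
reverseEach-prependSegment ([]    , _) = refl
reverseEach-prependSegment (_ ∷ _ , _) = refl

concat-blocks : ∀ π μ → length π ≤ length μ → concat (blocks π μ) ≡ π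
concat-blocks π μ π≤μ =
  trans (cong concat (blocks-split π μ)) (trans (concat-prependSegment (split μ π)) (split-concat μ π π≤μ))

map-length-blocks : ∀ μ {π π′} → length π ≡ length π′ → map length (blocks π μ) ≡ map length (blocks π′ μ)
map-length-blocks μ {π} {π′} e = begin
  map length (blocks π μ)                  ≡⟨ cong (map length) (blocks-split π μ) ⟩
  map length (prependSegment (split μ π))  ≡⟨ prependSegment-shape (split μ π) (split μ π′) (split-shape μ e) ⟩
  map length (prependSegment (split μ π′)) ≡⟨ cong (map length) (blocks-split π′ μ) ⟨
  map length (blocks π′ μ)                 ∎
  where open ≡-Reasoning

rev-split : ∀ π μ → rev π μ ≡ reverseSegments (split μ π)
rev-split π μ = trans (cong (concat ∘ map reverse) (blocks-split π μ)) (reverseEach-prependSegment (split μ π))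

length-rev : ∀ π μ → length π ≤ length μ → length (rev π μ) ≡ length π
length-rev π μ π≤μ = trans (length-reverseEach (blocks π μ)) (cong length (concat-blocks π μ π≤μ))

blocks-rev : ∀ π μ → length π ≤ length μ → blocks (rev π μ) μ ≡ map reverse (blocks π μ)
blocks-rev π μ π≤μ = concat-injective (blocks (rev π μ) μ) (map reverse (blocks π μ))
  (trans (map-length-blocks μ (length-rev π μ π≤μ)) (sym (map-length-reverseEach (blocks π μ))))
  (concat-blocks (rev π μ) μ (≤-trans (≤-reflexive (length-rev π μ π≤μ)) π≤μ))

rev-involutive : ∀ π μ → length π ≤ length μ → rev (rev π μ) μ ≡ π
rev-involutive π μ π≤μ = begin
  concat (map reverse (blocks (rev π μ) μ))       ≡⟨ cong (concat ∘ map reverse) (blocks-rev π μ π≤μ) ⟩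
  concat (map reverse (map reverse (blocks π μ))) ≡⟨ cong concat (reverseEach-involutive (blocks π μ)) ⟩
  concat (blocks π μ)                             ≡⟨ concat-blocks π μ π≤μ ⟩
  π                                               ∎
  where open ≡-Reasoning

data Before : List ℕ → ℕ → ℕ → Set where
  here  : ∀ {u v xs} → v ∈ xs → Before (u ∷ xs) u v
  there : ∀ {x u v xs} → Before xs u v → Before (x ∷ xs) u v

Before-∈ : ∀ {xs u v} → Before xs u v → u ∈ xs × v ∈ xs
Before-∈ (here v∈xs) = here refl , there v∈xs
Before-∈ (there bf)  = let u∈xs , v∈xs = Before-∈ bf in there u∈xs , there v∈xs

Before-++ʳ : ∀ xs {ys u v} → Before ys u v → Before (xs ++ ys) u v
Before-++ʳ []       bf = bf
Before-++ʳ (_ ∷ xs) bf = there (Before-++ʳ xs bf)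

Before-++-across : ∀ {xs ys u v} → u ∈ xs → v ∈ ys → Before (xs ++ ys) u v
Before-++-across {_ ∷ xs} (here refl) v∈ys = here (++⁺ʳ xs v∈ys)
Before-++-across (there u∈xs) v∈ys = there (Before-++-across u∈xs v∈ys)

Before-++⁻ : ∀ xs {ys u v} → Before (xs ++ ys) u v → Before xs u v ⊎ (u ∈ xs × v ∈ ys) ⊎ Before ys u v
Before-++⁻ []       bf = inj₂ (inj₂ bf)
Before-++⁻ (_ ∷ xs) (here v∈xs++ys) with ++⁻ xs v∈xs++ys
... | inj₁ v∈xs = inj₁ (here v∈xs)
... | inj₂ v∈ys = inj₂ (inj₁ (here refl , v∈ys))
Before-++⁻ (_ ∷ xs) (there bf) with Before-++⁻ xs bf
... | inj₁ bf′              = inj₁ (there bf′)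
... | inj₂ (inj₁ (u∈ , v∈)) = inj₂ (inj₁ (there u∈ , v∈))
... | inj₂ (inj₂ bf′)       = inj₂ (inj₂ bf′)

Before-insert : ∀ xs {ys w u v} → Before (xs ++ ys) u v → Before (xs ++ w ∷ ys) u v
Before-insert []       bf = there bf
Before-insert (_ ∷ xs) (here v∈xs++ys) with ++⁻ xs v∈xs++ys
... | inj₁ v∈xs = here (++⁺ˡ v∈xs)
... | inj₂ v∈ys = here (++⁺ʳ xs (there v∈ys))
Before-insert (_ ∷ xs) (there bf) = there (Before-insert xs bf)

Before-AllPairs : ∀ {R : ℕ → ℕ → Set} {xs u v} → AllPairs R xs → Before xs u v → R u v
Before-AllPairs (Rx ∷ _)  (here v∈xs) = ListAll.lookup Rx v∈xs
Before-AllPairs (_ ∷ Rxs) (there bf)  = Before-AllPairs Rxs bf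

SharedBlock : List (List ℕ) → ℕ → ℕ → Set
SharedBlock bs u v = ∃[ B ] (B ∈ bs × u ∈ B × v ∈ B)

SharedBlock-sym : ∀ {bs u v} → SharedBlock bs u v → SharedBlock bs v u
SharedBlock-sym (B , B∈bs , u∈B , v∈B) = B , B∈bs , v∈B , u∈B

Before-reverseEach : ∀ bs {u v} → Before (concat bs) u v → SharedBlock bs u v ⊎ Before (concat (map reverse bs)) u v
Before-reverseEach (b ∷ bs) bf with Before-++⁻ b bf
... | inj₁ bf′ = inj₁ (b , here refl , Before-∈ bf′)
... | inj₂ (inj₁ (u∈b , v∈bs)) =
  let B , v∈B , B∈bs = ∈-concat⁻′ bs v∈bs
  in inj₂ (Before-++-across (reverse⁺ u∈b) (∈-concat⁺′ (reverse⁺ v∈B) (∈-map⁺ reverse B∈bs)))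
... | inj₂ (inj₂ bf′) = map-⊎ (λ (B , B∈bs , u∈B , v∈B) → B , there B∈bs , u∈B , v∈B) (Before-++ʳ (reverse b)) (Before-reverseEach bs bf′)

Before-rev : ∀ π μ {u v} → length π ≤ length μ → Before π u v → SharedBlock (blocks π μ) u v ⊎ Before (rev π μ) u v
Before-rev π μ π≤μ bf = Before-reverseEach (blocks π μ) (subst (λ xs → Before xs _ _) (sym (concat-blocks π μ π≤μ)) bf)

Inverted : List ℕ → ℕ → ℕ → Set
Inverted xs a b = (b < a × Before xs a b) ⊎ (a < b × Before xs b a)

Inverted-sym : ∀ {xs a b} → Inverted xs a b → Inverted xs b a
Inverted-sym = swap

Inverted-rev : ∀ π μ {a b} → length π ≤ length μ → Inverted π a b → SharedBlock (blocks π μ) a b ⊎ Inverted (rev π μ) a b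
Inverted-rev π μ π≤μ (inj₁ (b<a , bf)) = map₂-⊎ (λ bf′ → inj₁ (b<a , bf′)) (Before-rev π μ π≤μ bf)
Inverted-rev π μ π≤μ (inj₂ (a<b , bf)) = map-⊎ SharedBlock-sym (λ bf′ → inj₂ (a<b , bf′)) (Before-rev π μ π≤μ bf)

¬Inverted-increasing : ∀ {xs a b} → AllPairs _<_ xs → ¬ Inverted xs a b
¬Inverted-increasing sorted (inj₁ (b<a , bf)) = <-asym b<a (Before-AllPairs sorted bf)
¬Inverted-increasing sorted (inj₂ (a<b , bf)) = <-asym a<b (Before-AllPairs sorted bf)

identity-increasing : ∀ n → AllPairs _<_ (identity n)
identity-increasing n = subst (AllPairs _<_) (sym (map-upTo suc n)) (applyUpTo⁺₁ suc n (λ i<j _ → s≤s i<j))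

reverse-∷-++ : ∀ (x : A) xs {ys} → reverse (x ∷ xs) ++ ys ≡ reverse xs ++ x ∷ ys
reverse-∷-++ x xs = trans (sym (ʳ++-defn (x ∷ xs))) (ʳ++-defn xs)

reverseSegments-∷ : ∀ c cs x xs →
  reverseSegments (split (c ∷ cs) (x ∷ xs)) ≡ reverse (proj₁ (split cs xs)) ++ x ∷ concat (map reverse (proj₂ (split cs xs)))
reverseSegments-∷ opA cs x xs = reverse-∷-++ x (proj₁ (split cs xs))
reverseSegments-∷ opD cs x xs = reverse-∷-++ x (proj₁ (split cs xs))

Before-reverseSegments-∷ : ∀ c cs x xs {u v} →
  Before (reverseSegments (split cs xs)) u v → Before (reverseSegments (split (c ∷ cs) (x ∷ xs))) u v
Before-reverseSegments-∷ c cs x xs bf =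
  subst (λ zs → Before zs _ _) (sym (reverseSegments-∷ c cs x xs)) (Before-insert (reverse (proj₁ (split cs xs))) bf)

-- μ has an `a` at the position of y, so x ends a block and y starts the next one.
Before-reverseSegments-boundary : ∀ pre {x y post} pre′ {post′} → length pre′ ≡ suc (length pre) →
  Before (reverseSegments (split (pre′ ++ opA ∷ post′) (pre ++ x ∷ y ∷ post))) x y
Before-reverseSegments-boundary [] {x} {y} {post} (c ∷ []) {post′} refl =
  subst (λ zs → Before zs x y) (sym (reverseSegments-∷ c (opA ∷ post′) x (y ∷ post)))
    (here (++⁺ˡ (reverse⁺ {xs = y ∷ proj₁ (split post′ post)} (here refl))))
Before-reverseSegments-boundary (p ∷ pre) {x} {y} {post} (c ∷ pre′) {post′} e =
  Before-reverseSegments-∷ c (pre′ ++ opA ∷ post′) p (pre ++ x ∷ y ∷ post)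
    (Before-reverseSegments-boundary pre pre′ (suc-injective e))

Before-reverseSegments-interior : ∀ pre {x y post} pre′ {post′} → length pre′ ≡ suc (length pre) →
  Before (reverseSegments (split (pre′ ++ opD ∷ post′) (pre ++ x ∷ y ∷ post))) y x
Before-reverseSegments-interior [] {x} {y} {post} (c ∷ []) {post′} refl =
  subst (λ zs → Before zs y x)
    (sym (trans (reverseSegments-∷ c (opD ∷ post′) x (y ∷ post)) (reverse-∷-++ y (proj₁ (split post′ post)))))
    (Before-++ʳ (reverse (proj₁ (split post′ post))) (here (here refl)))
Before-reverseSegments-interior (p ∷ pre) {x} {y} {post} (c ∷ pre′) {post′} e =
  Before-reverseSegments-∷ c (pre′ ++ opD ∷ post′) p (pre ++ x ∷ y ∷ post)
    (Before-reverseSegments-interior pre pre′ (suc-injective e))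

violation-inverted : ∀ {π μ a b} → ViolatingAt π μ a b → Inverted (rev π μ) a b
violation-inverted {π} {μ} {a} {b} (pre , x , y , post , π≡ , xy , order) = orient xy (inverted order)
  where
  moved : ∀ {u v} → Before (reverseSegments (split μ π)) u v → Before (rev π μ) u v
  moved = subst (λ zs → Before zs _ _) (sym (rev-split π μ))

  inverted : (x > y × LetterAt μ (suc (length pre)) opA) ⊎ (x < y × LetterAt μ (suc (length pre)) opD) →
    Inverted (rev π μ) x y
  inverted (inj₁ (y<x , pre′ , post′ , μ≡ , e)) =
    inj₁ (y<x , moved (subst₂ (λ m p → Before (reverseSegments (split m p)) x y) (sym μ≡) (sym π≡)
      (Before-reverseSegments-boundary pre pre′ e)))
  inverted (inj₂ (x<y , pre′ , post′ , μ≡ , e)) =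
    inj₂ (x<y , moved (subst₂ (λ m p → Before (reverseSegments (split m p)) y x) (sym μ≡) (sym π≡)
      (Before-reverseSegments-interior pre pre′ e)))

  orient : (x ≡ a × y ≡ b) ⊎ (x ≡ b × y ≡ a) → Inverted (rev π μ) x y → Inverted (rev π μ) a b
  orient (inj₁ (refl , refl)) = id
  orient (inj₂ (refl , refl)) = Inverted-sym

semitrace-∷ : ∀ n μ {k} (M : Vec (List Letter) k) → semitrace n (μ ∷ M) ≡ rev (lookup (semitrace n M) zero) μ ∷ semitrace n M
semitrace-∷ n μ M with semitrace n M
... | α ∷ T = refl

lookup-semitrace : ∀ n {k} (M : Vec (List Letter) k) j →
  lookup (semitrace n M) (inject₁ j) ≡ rev (lookup (semitrace n M) (suc j)) (lookup M j)
lookup-semitrace n (μ ∷ M) zero    rewrite semitrace-∷ n μ M = refl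
lookup-semitrace n (μ ∷ M) (suc j) rewrite semitrace-∷ n μ M = lookup-semitrace n M j

semitrace-fits : ∀ {n k μ} {M : Vec (List Letter) k} → All (IsOpSeq n) M → IsOpSeq n μ → ∀ t →
  length (lookup (semitrace n M) t) ≤ length μ

length-semitrace : ∀ {n k} {M : Vec (List Letter) k} → All (IsOpSeq n) M → ∀ t → length (lookup (semitrace n M) t) ≡ n
length-semitrace {n} {M = []}    []            zero    = trans (length-map suc (upTo n)) (length-upTo n)
length-semitrace {n} {M = μ ∷ M} (μ-op ∷ ops) zero    rewrite semitrace-∷ n μ M =
  trans (length-rev _ μ (semitrace-fits ops μ-op zero)) (length-semitrace ops zero)
length-semitrace {n} {M = μ ∷ M} (_ ∷ ops)    (suc t) rewrite semitrace-∷ n μ M = length-semitrace ops t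

semitrace-fits {n} ops (μ≡1+n , _) t =
  ≤-trans (≤-reflexive (length-semitrace ops t)) (≤-trans (n≤1+n n) (≤-reflexive (sym μ≡1+n)))

semitrace-involution : ∀ {n k} {M : Vec (List Letter) k} → All (IsOpSeq n) M → ∀ j →
  lookup (semitrace n M) (suc j) ≡ rev (lookup (semitrace n M) (inject₁ j)) (lookup M j)
semitrace-involution {n} {M = M} ops j = begin
  α                                          ≡⟨ rev-involutive α μ (semitrace-fits ops (lookup⁺ ops j) (suc j)) ⟨
  rev (rev α μ) μ                            ≡⟨ cong (λ β → rev β μ) (lookup-semitrace n M j) ⟨
  rev (lookup (semitrace n M) (inject₁ j)) μ ∎
  where
  open ≡-Reasoning
  α = lookup (semitrace n M) (suc j)
  μ = lookup M j

inverted-until-shared : ∀ {n k} {M : Vec (List Letter) k} {a b} → All (IsOpSeq n) M → (t : Fin (suc k)) →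
  Inverted (lookup (semitrace n M) t) a b →
  ∃[ j ] (toℕ t ≤ toℕ j × SharedBlock (blocks (lookup (semitrace n M) (inject₁ j)) (lookup M j)) a b)
inverted-until-shared {n} {M = []} [] zero inv = ⊥-elim (¬Inverted-increasing (identity-increasing n) inv)
inverted-until-shared {n} {M = μ ∷ M} (μ-op ∷ ops) zero inv rewrite semitrace-∷ n μ M =
  [ (λ shared → zero , z≤n , shared)
  , (λ inv′ → let j , _ , shared = inverted-until-shared ops zero (unrev inv′) in suc j , z≤n , shared)
  ]′ (Inverted-rev (rev α μ) μ rev-fits inv)
  where
  α = lookup (semitrace n M) zero
  α-fits : length α ≤ length μ
  α-fits = semitrace-fits ops μ-op zero
  rev-fits : length (rev α μ) ≤ length μ
  rev-fits = ≤-trans (≤-reflexive (length-rev α μ α-fits)) α-fits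
  unrev : ∀ {a b} → Inverted (rev (rev α μ) μ) a b → Inverted α a b
  unrev = subst (λ β → Inverted β _ _) (rev-involutive α μ α-fits)
inverted-until-shared {n} {M = μ ∷ M} (_ ∷ ops) (suc t) inv rewrite semitrace-∷ n μ M =
  let j , t≤j , shared = inverted-until-shared ops t inv in suc j , s≤s t≤j , shared

lemma6 : (n k : ℕ) (M : Vec (List Letter) k) → All (IsOpSeq n) M →
    (a b : ℕ) → ViolatingPair n M a b →
    ∃[ j ] (1 ≤ toℕ j × ∃[ B ] (B ∈ blocks (lookup (semitrace n M) (inject₁ j)) (lookup M j) × a ∈ B × b ∈ B))
lemma6 n k M ops a b (_ , j , violation) =
  let inverted = subst (λ α → Inverted α a b) (sym (semitrace-involution ops j)) (violation-inverted violation)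
      j′ , j<j′ , shared = inverted-until-shared ops (suc j) inverted
  in j′ , ≤-trans (s≤s z≤n) j<j′ , shared
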